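{- Let $p\equiv3\pmod4$ be a prime and $t\in\mathbb{F}_p$. Then the equation $y^2=x^3-(t^2+1)x$ over $\mathbb{F}_p$ defines a supersingular elliptic curve $E_t/\mathbb{F}_p$, and the point $(-1,t)$ is not divisible by $2$ in $E_t(\mathbb{F}_p)$, i.e. there is no $Q\in E_t(\mathbb{F}_p)$ with $2Q=(-1,t)$. -}

module Defs where

open import Data.Nat as ℕ using (ℕ; zero; suc)
open import Data.Nat.Divisibility using (_∣_; _∣?_)
open import Data.Integer as ℤ using (ℤ; +_; -[1+_]; _+_; _*_; _-_; -_; _^_; ∣_∣)
open import Data.Integer.Divisibility as ℤDiv using ()
open import Data.Bool using (Bool; true; false; if_then_else_)
open import Data.List using (List; length; upTo; map; filterᵇ; cartesianProduct)
open import Data.Product using (_×_; _,_)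
open import Data.Unit using (⊤)
open import Data.Empty using (⊥)
open import Relation.Nullary using (does)
open import Relation.Binary.PropositionalEquality using (_≡_)

-- The prime field F_p, modelled by integer representatives.
-- Two integers represent the same element of F_p iff p divides their
-- difference.

infix 4 _≡[_]_
_≡[_]_ : ℤ → ℕ → ℤ → Set
x ≡[ p ] y = p ∣ ∣ x - y ∣

eqᵇ : ℕ → ℤ → ℤ → Bool
eqᵇ p x y = does (p ∣? ∣ x - y ∣)

-- Inverse in F_p (p prime) via Fermat: u⁻¹ = u^(p-2)
inv : ℕ → ℤ → ℤ
inv p u = u ^ (p ℕ.∸ 2)

data Pt : Set where
  O  : Pt
  pt : ℤ → ℤ → Pt

infix 4 _≈[_]ₚ_
_≈[_]ₚ_ : Pt → ℕ → Pt → Set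
O ≈[ p ]ₚ O = ⊤
O ≈[ p ]ₚ pt _ _ = ⊥
pt _ _ ≈[ p ]ₚ O = ⊥
pt x y ≈[ p ]ₚ pt x′ y′ = (x ≡[ p ] x′) × (y ≡[ p ] y′)

curveRHS : ℤ → ℤ → ℤ → ℤ
curveRHS a b x = x * x * x + a * x + b

OnCurve : ℕ → ℤ → ℤ → Pt → Set
OnCurve p a b O = ⊤
OnCurve p a b (pt x y) = (y * y) ≡[ p ] curveRHS a b x

disc : ℤ → ℤ → ℤ
disc a b = - (+ 16) * ((+ 4) * (a * a * a) + (+ 27) * (b * b))

IsEllipticCurve : ℕ → ℤ → ℤ → Set
IsEllipticCurve p a b = (disc a b ≡[ p ] + 0) → ⊥

-- The chord-and-tangent group law on E(F_p) (b does not enter the formulas).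
add : ℕ → ℤ → Pt → Pt → Pt
add p a O Q = Q
add p a (pt x₁ y₁) O = pt x₁ y₁
add p a (pt x₁ y₁) (pt x₂ y₂) =
  if eqᵇ p x₁ x₂
  then (if eqᵇ p (y₁ + y₂) (+ 0)
        then O
        else tangent)
  else chord
  where
  chordP : ℤ → Pt
  chordP l = let x₃ = l * l - x₁ - x₂ in pt x₃ (l * (x₁ - x₃) - y₁)
  chord   = chordP ((y₂ - y₁) * inv p (x₂ - x₁))
  tangent = chordP (((+ 3) * (x₁ * x₁) + a) * inv p ((+ 2) * y₁))

-- Number of F_p-rational points of E, including the point at infinity.
numPoints : ℕ → ℤ → ℤ → ℕ
numPoints p a b =
  suc (length (filterᵇ (λ { (x , y) → eqᵇ p (y * y) (curveRHS a b x) })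
                       (cartesianProduct (map +_ (upTo p)) (map +_ (upTo p)))))

trace : ℕ → ℤ → ℤ → ℤ
trace p a b = + (suc p) - + (numPoints p a b)

Supersingular : ℕ → ℤ → ℤ → Set
Supersingular p a b = trace p a b ≡[ p ] + 0

-- Since p ≡ 3 (mod 4), -1 is not a square mod p: otherwise Fermat's little theorem would give
-- 1 ≡ w ^ (p - 1) = (w²) ^ ((p - 1) / 2) ≡ (-1) ^ odd = -1.  With a = -(t² + 1) this makes
-- a ≢ 0, hence Δ = -64 a³ ≢ 0.  For c ≢ 0 it also shows that exactly one of c, -c is a square
-- (of c ^ ((p + 1) / 4)), so the equations y² = c and y² = -c have two solutions together.
-- Pairing x with -x in the odd polynomial x³ + a x (x = 0 gives y = 0 alone) yields p affine
-- points, so #E = p + 1 and the trace vanishes.  Finally, the x-coordinate of 2(x, y) is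
-- ((x² - a) / 2y)², a square, so it is never -1.

module Submission where

open import Data.Bool using (Bool; true; false)
open import Data.Empty using (⊥-elim)
open import Data.Fin as Fin using (Fin; toℕ; fromℕ; inject₁)
import Data.Fin.Properties as Finₚ
open import Data.Nat.DivMod using (m*[n/m]≡n; m≡m%n+[m/n]*n)
open import Data.Nat.Primality using (Prime; euclidsLemma; prime⇒nonZero; prime⇒nonTrivial)
open import Data.Nat.Combinatorics using (_C_; nCn≡1; nCk≡n!/k![n-k]!; k![n∸k]!∣n!)
open import Data.Integer as ℤ using (ℤ; +_; _+_; _*_; _-_; -_; _^_; ∣_∣; -1ℤ)
import Data.Integer.Properties as ℤₚ
open import Data.Integer.DivMod using (_%ℕ_; _/ℕ_; a≡a%ℕn+[a/ℕn]*n; n%ℕd<d)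
open import Data.Integer.Divisibility.Signed as ℤ∣
  using (_∣_; divides; ∣ᵤ⇒∣; ∣⇒∣ᵤ; ∣m∣n⇒∣m+n; ∣m⇒∣-m; ∣n⇒∣m*n; ∣m⇒∣m*n)
open import Data.Integer.Tactic.RingSolver using (solve-∀)
import Data.Nat.Tactic.RingSolver as ℕSolver
open import Data.List using ([]; _∷_; map; length; filterᵇ; cartesianProduct; applyUpTo; upTo; _++_)
import Data.List.Properties as Listₚ
open import Data.Nat as ℕ using (ℕ; zero; suc; z≤n; s≤s; _∸_; _<_; _≤_; _%_; _/_; _!)
import Data.Nat.Divisibility as ℕ∣
open import Data.Nat.ListAction using (sum)
open import Data.Nat.ListAction.Properties using (sum-++)
import Data.Nat.Properties as ℕₚ
open import Algebra.Properties.CommutativeSemigroup ℕₚ.+-commutativeSemigroup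
  using () renaming (interchange to +-interchange)
open import Data.Product using (_×_; _,_; ∃; proj₁)
open import Data.Sum as Sum using (_⊎_; inj₁; inj₂)
open import Function using (_∘_; id; case_of_)
open import Relation.Nullary using (¬_; Dec; yes; no; does)
open import Relation.Nullary.Decidable using (dec-true; dec-false)
open import Relation.Binary.PropositionalEquality
open import Relation.Binary.Bundles using (Setoid)
open import Defs

χ : Bool → ℕ
χ true  = 1
χ false = 0

∑< : ℕ → (ℕ → ℕ) → ℕ
∑< n f = sum (applyUpTo f n)

syntax ∑< n (λ i → e) = ∑[ i < n ] e

∑-cong : ∀ n {f g : ℕ → ℕ} → (∀ i → i < n → f i ≡ g i) → ∑< n f ≡ ∑< n g
∑-cong zero    f≗g = refl
∑-cong (suc n) f≗g = cong₂ ℕ._+_ (f≗g 0 (s≤s z≤n)) (∑-cong n (λ i i<n → f≗g (suc i) (s≤s i<n)))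

∑-+ : ∀ n (f g : ℕ → ℕ) → ∑[ i < n ] (f i ℕ.+ g i) ≡ ∑< n f ℕ.+ ∑< n g
∑-+ zero    f g = refl
∑-+ (suc n) f g = trans (cong (f 0 ℕ.+ g 0 ℕ.+_) (∑-+ n (f ∘ suc) (g ∘ suc)))
                        (+-interchange (f 0) (g 0) _ _)

∑-const : ∀ n c → ∑[ i < n ] c ≡ n ℕ.* c
∑-const zero    c = refl
∑-const (suc n) c = cong (c ℕ.+_) (∑-const n c)

δ : ℕ → ℕ → ℕ
δ i j = χ (does (i ℕₚ.≟ j))

δ-refl : ∀ i → δ i i ≡ 1
δ-refl i = cong χ (dec-true (i ℕₚ.≟ i) refl)

δ-≢ : ∀ {i j} → ¬ i ≡ j → δ i j ≡ 0
δ-≢ {i} {j} i≢j = cong χ (dec-false (i ℕₚ.≟ j) i≢j)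

∑-δ : ∀ n {j} → j < n → ∑[ i < n ] δ i j ≡ 1
∑-δ (suc n) {zero} _ =
  cong suc (trans (∑-cong n (λ _ _ → refl)) (trans (∑-const n 0) (ℕₚ.*-zeroʳ n)))
∑-δ (suc n) {suc j} (s≤s j<n) =
  trans (∑-cong n (λ i _ → cong χ (suc-≟ i))) (∑-δ n j<n)
  where
  suc-≟ : ∀ i → does (suc i ℕₚ.≟ suc j) ≡ does (i ℕₚ.≟ j)
  suc-≟ i with i ℕₚ.≟ j
  ... | yes refl = refl
  ... | no _     = refl

∑-last : ∀ n f → ∑< (suc n) f ≡ ∑< n f ℕ.+ f n
∑-last zero    f = ℕₚ.+-comm (f 0) 0
∑-last (suc n) f = trans (cong (f 0 ℕ.+_) (∑-last n (f ∘ suc))) (sym (ℕₚ.+-assoc (f 0) _ _))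

∑-reverse : ∀ n f → ∑< n f ≡ ∑[ i < n ] f (n ∸ suc i)
∑-reverse zero    f = refl
∑-reverse (suc n) f = begin
  f 0 ℕ.+ ∑< n (f ∘ suc)                        ≡⟨ cong (f 0 ℕ.+_) (∑-reverse n (f ∘ suc)) ⟩
  f 0 ℕ.+ ∑[ i < n ] f (suc (n ∸ suc i))        ≡⟨ ℕₚ.+-comm (f 0) _ ⟩
  ∑[ i < n ] f (suc (n ∸ suc i)) ℕ.+ f 0        ≡⟨ cong₂ ℕ._+_ (∑-cong n (λ i i<n → cong f (sym (ℕₚ.+-∸-assoc 1 i<n))))
                                                               (cong f (sym (ℕₚ.n∸n≡0 n))) ⟩
  ∑[ i < n ] f (n ∸ i) ℕ.+ f (n ∸ n)            ≡⟨ ∑-last n (λ i → f (n ∸ i)) ⟨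
  ∑[ i < suc n ] f (suc n ∸ suc i)              ∎
  where open ≡-Reasoning

-- Pairing i with n ∸ suc i: the sum counted twice is n copies of 2.
∑-complementary-pairs : ∀ n (g : ℕ → ℕ) → (∀ i → i < n → g i ℕ.+ g (n ∸ suc i) ≡ 2) → ∑< n g ≡ n
∑-complementary-pairs n g pairs = ℕₚ.*-cancelˡ-≡ (∑< n g) n 2 (begin
  2 ℕ.* ∑< n g                                ≡⟨ cong (∑< n g ℕ.+_) (ℕₚ.+-identityʳ (∑< n g)) ⟩
  ∑< n g ℕ.+ ∑< n g                           ≡⟨ cong (∑< n g ℕ.+_) (∑-reverse n g) ⟩
  ∑< n g ℕ.+ ∑[ i < n ] g (n ∸ suc i)         ≡⟨ ∑-+ n g (λ i → g (n ∸ suc i)) ⟨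
  ∑[ i < n ] (g i ℕ.+ g (n ∸ suc i))          ≡⟨ ∑-cong n pairs ⟩
  ∑[ i < n ] 2                                ≡⟨ ∑-const n 2 ⟩
  n ℕ.* 2                                     ≡⟨ ℕₚ.*-comm n 2 ⟩
  2 ℕ.* n                                     ∎)
  where open ≡-Reasoning

∑-negation-pairs : ∀ n (g : ℕ → ℕ) → g 0 ≡ 1 →
                   (∀ i → 0 < i → i < n → g i ℕ.+ g (n ∸ i) ≡ 2) → ∑< n g ≡ n
∑-negation-pairs zero    g g0 pairs = refl
∑-negation-pairs (suc n) g g0 pairs =
  cong₂ ℕ._+_ g0 (∑-complementary-pairs n (g ∘ suc) (λ i i<n →
    subst (λ m → g (suc i) ℕ.+ g m ≡ 2) (ℕₚ.+-∸-assoc 1 i<n) (pairs (suc i) (s≤s z≤n) (s≤s i<n))))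

length-filterᵇ : ∀ {A : Set} (F : A → Bool) xs → length (filterᵇ F xs) ≡ sum (map (χ ∘ F) xs)
length-filterᵇ F []       = refl
length-filterᵇ F (x ∷ xs) with F x
... | true  = cong suc (length-filterᵇ F xs)
... | false = length-filterᵇ F xs

sum-map-upTo : ∀ {A : Set} (g : A → ℕ) (f : ℕ → A) n → sum (map g (map f (upTo n))) ≡ ∑[ i < n ] g (f i)
sum-map-upTo g f n = cong sum (trans (cong (map g) (Listₚ.map-upTo f n)) (Listₚ.map-applyUpTo f g n))

module _ {A B : Set} where

  sum-cartesianProduct : ∀ (g : A × B → ℕ) xs ys →
    sum (map g (cartesianProduct xs ys)) ≡ sum (map (λ x → sum (map (λ y → g (x , y)) ys)) xs)
  sum-cartesianProduct g []       ys = refl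
  sum-cartesianProduct g (x ∷ xs) ys = begin
    sum (map g (map (x ,_) ys ++ cartesianProduct xs ys))
      ≡⟨ cong sum (Listₚ.map-++ g (map (x ,_) ys) _) ⟩
    sum (map g (map (x ,_) ys) ++ map g (cartesianProduct xs ys))
      ≡⟨ sum-++ (map g (map (x ,_) ys)) _ ⟩
    sum (map g (map (x ,_) ys)) ℕ.+ sum (map g (cartesianProduct xs ys))
      ≡⟨ cong₂ ℕ._+_ (cong sum (sym (Listₚ.map-∘ ys))) (sum-cartesianProduct g xs ys) ⟩
    sum (map (λ y → g (x , y)) ys) ℕ.+ sum (map (λ x → sum (map (λ y → g (x , y)) ys)) xs)
      ∎
    where open ≡-Reasoning

  count-grid : ∀ (F : A × B → Bool) (f : ℕ → A) (g : ℕ → B) m n →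
    length (filterᵇ F (cartesianProduct (map f (upTo m)) (map g (upTo n))))
      ≡ ∑[ i < m ] ∑[ j < n ] χ (F (f i , g j))
  count-grid F f g m n = begin
    length (filterᵇ F (cartesianProduct xs ys))                 ≡⟨ length-filterᵇ F (cartesianProduct xs ys) ⟩
    sum (map (χ ∘ F) (cartesianProduct xs ys))                  ≡⟨ sum-cartesianProduct (χ ∘ F) xs ys ⟩
    sum (map (λ x → sum (map (λ y → χ (F (x , y))) ys)) xs)     ≡⟨ sum-map-upTo _ f m ⟩
    ∑[ i < m ] sum (map (λ y → χ (F (f i , y))) ys)             ≡⟨ ∑-cong m (λ i _ → sum-map-upTo _ g n) ⟩
    ∑[ i < m ] ∑[ j < n ] χ (F (f i , g j))                     ∎
    where
    open ≡-Reasoning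
    xs = map f (upTo m)
    ys = map g (upTo n)

module Congruence (n : ℕ) where

  -- A record rather than a synonym so that x and y can be inferred from a proof of x ≈ y.
  infix 4 _≈_
  record _≈_ (x y : ℤ) : Set where
    constructor ≈-intro
    field ∣-difference : + n ∣ x - y
  open _≈_ public

  ≈-via : ∀ {x y} e → x - y ≡ e → + n ∣ e → x ≈ y
  ≈-via e refl n∣e = ≈-intro n∣e

  ≈-refl : ∀ {x} → x ≈ x
  ≈-refl {x} = ≈-via (+ 0) (ℤₚ.+-inverseʳ x) (divides (+ 0) refl)

  ≈-reflexive : ∀ {x y} → x ≡ y → x ≈ y
  ≈-reflexive refl = ≈-refl

  ≈-sym : ∀ {x y} → x ≈ y → y ≈ x
  ≈-sym {x} {y} (≈-intro d) = ≈-via _ (flip x y) (∣m⇒∣-m d)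
    where
    flip : ∀ x y → y - x ≡ - (x - y)
    flip = solve-∀

  ≈-trans : ∀ {x y z} → x ≈ y → y ≈ z → x ≈ z
  ≈-trans {x} {y} {z} (≈-intro d) (≈-intro e) = ≈-via _ (telescope x y z) (∣m∣n⇒∣m+n d e)
    where
    telescope : ∀ x y z → x - z ≡ (x - y) + (y - z)
    telescope = solve-∀

  ≈-setoid : Setoid _ _
  ≈-setoid = record
    { Carrier = ℤ ; _≈_ = _≈_
    ; isEquivalence = record { refl = ≈-refl ; sym = ≈-sym ; trans = ≈-trans } }

  +-cong : ∀ {x y u v} → x ≈ y → u ≈ v → x + u ≈ y + v
  +-cong {x} {y} {u} {v} (≈-intro d) (≈-intro e) = ≈-via _ (split x y u v) (∣m∣n⇒∣m+n d e)
    where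
    split : ∀ x y u v → (x + u) - (y + v) ≡ (x - y) + (u - v)
    split = solve-∀

  *-cong : ∀ {x y u v} → x ≈ y → u ≈ v → x * u ≈ y * v
  *-cong {x} {y} {u} {v} (≈-intro d) (≈-intro e) =
    ≈-via _ (split x y u v) (∣m∣n⇒∣m+n (∣n⇒∣m*n u d) (∣n⇒∣m*n y e))
    where
    split : ∀ x y u v → (x * u) - (y * v) ≡ u * (x - y) + y * (u - v)
    split = solve-∀

  neg-cong : ∀ {x y} → x ≈ y → - x ≈ - y
  neg-cong {x} {y} (≈-intro d) = ≈-via _ (split x y) (∣m⇒∣-m d)
    where
    split : ∀ x y → (- x) - (- y) ≡ - (x - y)
    split = solve-∀

  ^-cong : ∀ {x y} m → x ≈ y → x ^ m ≈ y ^ m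
  ^-cong zero    x≈y = ≈-refl
  ^-cong (suc m) x≈y = *-cong x≈y (^-cong m x≈y)

  ∣⇒≈0 : ∀ {x} → + n ∣ x → x ≈ + 0
  ∣⇒≈0 {x} = ≈-intro ∘ subst (+ n ∣_) (sym (ℤₚ.+-identityʳ x))

  ≈0⇒∣ : ∀ {x} → x ≈ + 0 → + n ∣ x
  ≈0⇒∣ {x} = subst (+ n ∣_) (ℤₚ.+-identityʳ x) ∘ ∣-difference

  ∣-neg⁻¹ : ∀ {x} → + n ∣ - x → + n ∣ x
  ∣-neg⁻¹ {x} = subst (+ n ∣_) (ℤₚ.neg-involutive x) ∘ ∣m⇒∣-m

  ≈⇒≡[] : ∀ {x y} → x ≈ y → x ≡[ n ] y
  ≈⇒≡[] = ∣⇒∣ᵤ ∘ ∣-difference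

  ≡[]⇒≈ : ∀ {x y} → x ≡[ n ] y → x ≈ y
  ≡[]⇒≈ = ≈-intro ∘ ∣ᵤ⇒∣

  eqᵇ-true : ∀ {x y} → x ≈ y → eqᵇ n x y ≡ true
  eqᵇ-true {x} {y} x≈y = dec-true (n ℕ∣.∣? ∣ x - y ∣) (≈⇒≡[] x≈y)

  eqᵇ-false : ∀ {x y} → ¬ x ≈ y → eqᵇ n x y ≡ false
  eqᵇ-false {x} {y} x≉y = dec-false (n ℕ∣.∣? ∣ x - y ∣) (x≉y ∘ ≡[]⇒≈)

  eqᵇ-respʳ : ∀ x {c c′} → c ≈ c′ → eqᵇ n x c ≡ eqᵇ n x c′
  eqᵇ-respʳ x {c} {c′} c≈c′ with n ℕ∣.∣? ∣ x - c ∣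
  ... | yes x≈c = sym (eqᵇ-true (≈-trans (≡[]⇒≈ {x} x≈c) c≈c′))
  ... | no  x≉c = sym (eqᵇ-false (λ x≈c′ → x≉c (≈⇒≡[] {x} (≈-trans x≈c′ (≈-sym c≈c′)))))

  <∧∣⇒≡0 : ∀ {m} → m < n → + n ∣ + m → m ≡ 0
  <∧∣⇒≡0 {zero}  _   _   = refl
  <∧∣⇒≡0 {suc m} m<n n∣m = ⊥-elim (ℕ∣.>⇒∤ m<n (∣⇒∣ᵤ n∣m))

  residue-injective-≥ : ∀ {i j} → j ≤ i → i < n → + i ≈ + j → i ≡ j
  residue-injective-≥ {i} {j} j≤i i<n (≈-intro n∣i-j) =
    ℕₚ.≤-antisym (ℕₚ.m∸n≡0⇒m≤n (<∧∣⇒≡0 (ℕₚ.≤-<-trans (ℕₚ.m∸n≤m i j) i<n) n∣i∸j)) j≤i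
    where
    n∣i∸j : + n ∣ + (i ∸ j)
    n∣i∸j = subst (+ n ∣_) (trans (ℤₚ.m-n≡m⊖n i j) (ℤₚ.⊖-≥ j≤i)) n∣i-j

  residue-injective : ∀ {i j} → i < n → j < n → + i ≈ + j → i ≡ j
  residue-injective {i} {j} i<n j<n i≈j with ℕₚ.≤-total j i
  ... | inj₁ j≤i = residue-injective-≥ j≤i i<n i≈j
  ... | inj₂ i≤j = sym (residue-injective-≥ i≤j j<n (≈-sym i≈j))

  ≈-%ℕ : ∀ z .{{_ : ℕ.NonZero n}} → z ≈ + (z %ℕ n)
  ≈-%ℕ z = ≈-via ((z /ℕ n) * + n)
    (trans (cong (_- + (z %ℕ n)) (a≡a%ℕn+[a/ℕn]*n z n)) (cancel (+ (z %ℕ n)) (z /ℕ n) (+ n)))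
    (∣n⇒∣m*n (z /ℕ n) ℤ∣.∣-refl)
    where
    cancel : ∀ r q m → (r + q * m) - r ≡ q * m
    cancel = solve-∀

  ∸≈- : ∀ {i} → i ≤ n → + (n ∸ i) ≈ - + i
  ∸≈- {i} i≤n = ≈-via (+ n) eq ℤ∣.∣-refl
    where
    eq : + (n ∸ i) - - + i ≡ + n
    eq = trans (cong (_+_ (+ (n ∸ i))) (ℤₚ.neg-involutive (+ i)))
               (trans (sym (ℤₚ.pos-+ (n ∸ i) i)) (cong +_ (ℕₚ.m∸n+n≡m i≤n)))

  rootCount : ℤ → ℕ
  rootCount c = ∑[ j < n ] χ (eqᵇ n (+ j * + j) c)

  rootCount-cong : ∀ {c c′} → c ≈ c′ → rootCount c ≡ rootCount c′
  rootCount-cong c≈c′ = ∑-cong n (λ j _ → cong χ (eqᵇ-respʳ (+ j * + j) c≈c′))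

  rootCount-nonSquare : ∀ {c} → (∀ w → ¬ w * w ≈ c) → rootCount c ≡ 0
  rootCount-nonSquare nonSquare =
    trans (∑-cong n (λ j _ → cong χ (eqᵇ-false (nonSquare (+ j))))) (trans (∑-const n 0) (ℕₚ.*-zeroʳ n))

  module _ where
    open import Algebra.Bundles using (CommutativeSemiring)
    open import Algebra.Properties.CommutativeSemiring.Binomial ℤₚ.+-*-commutativeSemiring
      using (binomialTerm; binomial) renaming (theorem to binomial-theorem)
    open import Algebra.Properties.Semiring.Exp (CommutativeSemiring.semiring ℤₚ.+-*-commutativeSemiring)
      using () renaming (_^_ to _^ₛ_)
    open import Algebra.Definitions.RawMonoid ℤ.+-0-rawMonoid using () renaming (sum to ∑ℤ; _×_ to _·_)

    ^ₛ≡^ : ∀ x m → x ^ₛ m ≡ x ^ m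
    ^ₛ≡^ x zero    = refl
    ^ₛ≡^ x (suc m) = cong (x *_) (^ₛ≡^ x m)

    ·≡* : ∀ m z → m · z ≡ + m * z
    ·≡* zero    z = refl
    ·≡* (suc m) z = trans (cong (_+_ z) (·≡* m z)) (sym (ℤₚ.suc-* (+ m) z))

    ∑ℤ-≈-last : ∀ m (t : Fin (suc m) → ℤ) → (∀ i → + n ∣ t (inject₁ i)) → ∑ℤ t ≈ t (fromℕ m)
    ∑ℤ-≈-last zero    t n∣t = ≈-reflexive (ℤₚ.+-identityʳ (t Fin.zero))
    ∑ℤ-≈-last (suc m) t n∣t = ≈-trans (+-cong (∣⇒≈0 (n∣t Fin.zero)) (∑ℤ-≈-last m (t ∘ Fin.suc) (n∣t ∘ Fin.suc)))
                                      (≈-reflexive (ℤₚ.+-identityˡ _))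

    -- Only the two extreme terms of the binomial expansion survive modulo n.
    freshmans-dream : ∀ m .{{_ : ℕ.NonZero m}} → (∀ k → 0 < k → k < m → n ℕ∣.∣ m C k) →
               ∀ x → (x + + 1) ^ m ≈ x ^ m + + 1
    freshmans-dream (suc q) n∣C x = begin
      (x + + 1) ^ suc q                          ≡⟨ ^ₛ≡^ (x + + 1) (suc q) ⟨
      (x + + 1) ^ₛ suc q                         ≡⟨ binomial-theorem (suc q) x (+ 1) ⟩
      t Fin.zero + ∑ℤ (t ∘ Fin.suc)              ≈⟨ +-cong (≈-refl {t Fin.zero}) (∑ℤ-≈-last q (t ∘ Fin.suc) inner) ⟩
      t Fin.zero + t (fromℕ (suc q))             ≡⟨ cong₂ _+_ first last ⟩
      + 1 + x ^ suc q                            ≡⟨ ℤₚ.+-comm (+ 1) (x ^ suc q) ⟩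
      x ^ suc q + + 1                            ∎
      where
      open import Relation.Binary.Reasoning.Setoid ≈-setoid
      t = binomialTerm x (+ 1) (suc q)
      first : t Fin.zero ≡ + 1
      first = trans (·≡* 1 _) (trans (ℤₚ.*-identityˡ _) (trans (ℤₚ.*-identityˡ _)
                (trans (^ₛ≡^ (+ 1) (suc q)) (ℤₚ.^-zeroˡ (suc q)))))
      last : t (fromℕ (suc q)) ≡ x ^ suc q
      last = trans (·≡* (suc q C toℕ top) (binomial x (+ 1) (suc q) top))
                   (extreme (toℕ top) (Finₚ.toℕ-fromℕ (suc q)))
        where
        extreme : ∀ k → k ≡ suc q → + (suc q C k) * (x ^ₛ k * (+ 1) ^ₛ (suc q ∸ k)) ≡ x ^ suc q
        extreme .(suc q) refl rewrite nCn≡1 (suc q) | ℕₚ.n∸n≡0 (suc q) =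
          trans (ℤₚ.*-identityˡ _) (trans (ℤₚ.*-identityʳ _) (^ₛ≡^ x (suc q)))
        top = fromℕ (suc q)
      inner : ∀ i → + n ∣ t (Fin.suc (inject₁ i))
      inner i = subst (+ n ∣_) (sym (·≡* (suc q C toℕ k) (binomial x (+ 1) (suc q) k)))
                  (∣m⇒∣m*n (binomial x (+ 1) (suc q) k) (∣ᵤ⇒∣ {+ n} {+ (suc q C toℕ k)} n∣C[k]))
        where
        k = Fin.suc (inject₁ i)
        n∣C[k] = n∣C (toℕ k) (s≤s z≤n) (s≤s (Finₚ.inject₁ℕ< i))

module PrimeModulus (p : ℕ) (p-prime : Prime p) where

  open Congruence p public

  instance
    p≢0 : ℕ.NonZero p
    p≢0 = prime⇒nonZero p-prime

  1<p : 1 < p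
  1<p = ℕ.nonTrivial⇒n>1 p {{prime⇒nonTrivial p-prime}}

  p∤1 : ¬ + p ∣ + 1
  p∤1 p∣1 with () ← <∧∣⇒≡0 1<p p∣1

  euclid : ∀ x y → + p ∣ x * y → (+ p ∣ x) ⊎ (+ p ∣ y)
  euclid x y p∣xy =
    Sum.map ∣ᵤ⇒∣ ∣ᵤ⇒∣ (euclidsLemma ∣ x ∣ ∣ y ∣ p-prime (subst (p ℕ∣.∣_) (ℤₚ.abs-* x y) (∣⇒∣ᵤ p∣xy)))

  ∤-* : ∀ {x y} → ¬ + p ∣ x → ¬ + p ∣ y → ¬ + p ∣ x * y
  ∤-* {x} {y} p∤x p∤y p∣xy = Sum.[ p∤x , p∤y ] (euclid x y p∣xy)

  ∤-^ : ∀ {x} m → ¬ + p ∣ x → ¬ + p ∣ x ^ m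
  ∤-^ zero    p∤x = p∤1
  ∤-^ (suc m) p∤x = ∤-* p∤x (∤-^ m p∤x)

  ∣-square : ∀ {x} → + p ∣ x * x → + p ∣ x
  ∣-square {x} p∣xx = Sum.[ id , id ] (euclid x x p∣xx)

  prime∤! : ∀ {m} → m < p → ¬ p ℕ∣.∣ m !
  prime∤! {zero}  _   p∣1  = ℕₚ.<⇒≢ 1<p (sym (ℕ∣.∣1⇒≡1 p∣1))
  prime∤! {suc m} m<p p∣m! =
    Sum.[ ℕ∣.>⇒∤ m<p , prime∤! (ℕₚ.<-trans (ℕₚ.n<1+n m) m<p) ] (euclidsLemma (suc m) (m !) p-prime p∣m!)

  prime∣C : ∀ k → 0 < k → k < p → p ℕ∣.∣ p C k
  prime∣C k 0<k k<p =
    Sum.[ ⊥-elim ∘ p∤k![p∸k]! , id ] (euclidsLemma (k ! ℕ.* (p ∸ k) !) (p C k) p-prime p∣product)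
    where
    k≤p = ℕₚ.<⇒≤ k<p
    instance _ = k ℕₚ.!* (p ∸ k) !≢0
    p∣product : p ℕ∣.∣ k ! ℕ.* (p ∸ k) ! ℕ.* (p C k)
    p∣product = subst (p ℕ∣.∣_)
      (sym (trans (cong (k ! ℕ.* (p ∸ k) ! ℕ.*_) (nCk≡n!/k![n-k]! k≤p)) (m*[n/m]≡n (k![n∸k]!∣n! k≤p))))
      (subst (λ m → m ℕ∣.∣ m !) (ℕₚ.suc-pred p) (ℕ∣.m∣m*n (ℕ.pred p !)))
    p∤k![p∸k]! : ¬ p ℕ∣.∣ k ! ℕ.* (p ∸ k) !
    p∤k![p∸k]! p∣ = Sum.[ prime∤! k<p , prime∤! (ℕₚ.∸-monoʳ-< {p} {k} {0} 0<k k≤p) ]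
                      (euclidsLemma (k !) ((p ∸ k) !) p-prime p∣)

  ^-pred : ∀ z → z ^ p ≡ z * z ^ ℕ.pred p
  ^-pred z = subst (λ m → z ^ m ≡ z * z ^ ℕ.pred m) (ℕₚ.suc-pred p) refl

  fermat-ℕ : ∀ m → (+ m) ^ p ≈ + m
  fermat-ℕ zero    = ≈-reflexive (^-pred (+ 0))
  fermat-ℕ (suc m) = begin
    (+ suc m) ^ p        ≡⟨ cong (_^ p) (ℤₚ.+-comm (+ 1) (+ m)) ⟩
    (+ m + + 1) ^ p      ≈⟨ freshmans-dream p prime∣C (+ m) ⟩
    (+ m) ^ p + + 1      ≈⟨ +-cong (fermat-ℕ m) ≈-refl ⟩
    + m + + 1            ≡⟨ ℤₚ.+-comm (+ m) (+ 1) ⟩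
    + suc m              ∎
    where open import Relation.Binary.Reasoning.Setoid ≈-setoid

  fermat : ∀ z → z ^ p ≈ z
  fermat z = ≈-trans (^-cong p (≈-%ℕ z)) (≈-trans (fermat-ℕ (z %ℕ p)) (≈-sym (≈-%ℕ z)))

  fermat-unit : ∀ {z} → ¬ + p ∣ z → z ^ ℕ.pred p ≈ + 1
  fermat-unit {z} p∤z = ≈-intro (Sum.[ ⊥-elim ∘ p∤z , id ] (euclid z (z ^ ℕ.pred p - + 1) p∣z[zᵖ⁻¹-1]))
    where
    p∣z[zᵖ⁻¹-1] : + p ∣ z * (z ^ ℕ.pred p - + 1)
    p∣z[zᵖ⁻¹-1] = subst (+ p ∣_) (factor z (z ^ ℕ.pred p)) (∣-difference (≈-trans (≈-reflexive (sym (^-pred z))) (fermat z)))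
      where
      factor : ∀ z w → z * w - z ≡ z * (w - + 1)
      factor = solve-∀

  inv-inverseʳ : ∀ {u} → ¬ + p ∣ u → u * inv p u ≈ + 1
  inv-inverseʳ {u} p∤u = ≈-trans (≈-reflexive (cong (u ^_) (sym (ℕₚ.+-∸-assoc 1 1<p)))) (fermat-unit p∤u)

  ±-roots : ∀ {s w c} → s * s ≈ c → w * w ≈ c → w ≈ s ⊎ w ≈ - s
  ±-roots {s} {w} s²≈c w²≈c = Sum.map ≈-intro ≈-intro
    (euclid (w - s) (w - - s) (subst (+ p ∣_) (difference-of-squares w s) (∣-difference (≈-trans w²≈c (≈-sym s²≈c)))))
    where
    difference-of-squares : ∀ w s → w * w - s * s ≡ (w - s) * (w - - s)
    difference-of-squares = solve-∀

  rootCount-zero : ∀ {c} → c ≈ + 0 → rootCount c ≡ 1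
  rootCount-zero {c} c≈0 = trans (∑-cong p pointwise) (∑-δ p (ℕₚ.<-trans (s≤s z≤n) 1<p))
    where
    pointwise : ∀ j → j < p → χ (eqᵇ p (+ j * + j) c) ≡ δ j 0
    pointwise zero    _   = cong χ (eqᵇ-true (≈-sym c≈0))
    pointwise (suc j) j<p = cong χ (eqᵇ-false (λ j²≈c →
      case <∧∣⇒≡0 j<p (∣-square (≈0⇒∣ (≈-trans j²≈c c≈0))) of λ ()))

-1^odd : ∀ k → -1ℤ ^ (1 ℕ.+ 2 ℕ.* k) ≡ -1ℤ
-1^odd k = cong (-1ℤ *_) (trans (sym (ℤₚ.^-*-assoc -1ℤ 2 k)) (ℤₚ.^-zeroˡ k))

module ThreeModFour (p : ℕ) (p-prime : Prime p) (p≡3 : p % 4 ≡ 3) where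

  open PrimeModulus p p-prime public

  k : ℕ
  k = p / 4

  p≡3+k*4 : p ≡ 3 ℕ.+ k ℕ.* 4
  p≡3+k*4 = trans (m≡m%n+[m/n]*n p 4) (cong (ℕ._+ k ℕ.* 4) p≡3)

  pred-p≡2*odd : ℕ.pred p ≡ 2 ℕ.* (1 ℕ.+ 2 ℕ.* k)
  pred-p≡2*odd = trans (cong ℕ.pred p≡3+k*4) (arith k)
    where
    arith : ∀ k → 2 ℕ.+ k ℕ.* 4 ≡ 2 ℕ.* (1 ℕ.+ 2 ℕ.* k)
    arith = ℕSolver.solve-∀

  p∤2 : ¬ + p ∣ + 2
  p∤2 p∣2 with () ← <∧∣⇒≡0 (subst (2 <_) (sym p≡3+k*4) (ℕₚ.m≤m+n 3 (k ℕ.* 4))) p∣2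

  ≈-neg-self⇒∣ : ∀ {x} → x ≈ - x → + p ∣ x
  ≈-neg-self⇒∣ {x} x≈-x = Sum.[ ⊥-elim ∘ p∤2 , id ] (euclid (+ 2) x (subst (+ p ∣_) (double x) (∣-difference x≈-x)))
    where
    double : ∀ x → x - - x ≡ + 2 * x
    double = solve-∀

  -1-nonSquare : ∀ w → ¬ w * w ≈ -1ℤ
  -1-nonSquare w w²≈-1 = p∤2 (∣-difference (≈-trans (≈-sym (fermat-unit p∤w)) w^[p-1]≈-1))
    where
    open import Relation.Binary.Reasoning.Setoid ≈-setoid
    p∤w : ¬ + p ∣ w
    p∤w p∣w = p∤1 (ℤ∣.∣m+n∣m⇒∣n (∣-difference w²≈-1) (∣n⇒∣m*n w p∣w))
    m = 1 ℕ.+ 2 ℕ.* k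
    w^[p-1]≈-1 : w ^ ℕ.pred p ≈ -1ℤ
    w^[p-1]≈-1 = begin
      w ^ ℕ.pred p      ≡⟨ cong (w ^_) pred-p≡2*odd ⟩
      w ^ (2 ℕ.* m)     ≡⟨ ℤₚ.^-*-assoc w 2 m ⟨
      (w ^ 2) ^ m       ≡⟨ cong (λ v → (w * v) ^ m) (ℤₚ.*-identityʳ w) ⟩
      (w * w) ^ m       ≈⟨ ^-cong m w²≈-1 ⟩
      -1ℤ ^ m           ≡⟨ -1^odd k ⟩
      -1ℤ               ∎

  -- Euler's criterion with an explicit root: c ^ ((p + 1) / 4) squares to c · c ^ ((p - 1) / 2) = ± c.
  square-or-neg-square : ∀ {c} → ¬ + p ∣ c → let s = c ^ suc k in s * s ≈ c ⊎ s * s ≈ - c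
  square-or-neg-square {c} p∤c =
    Sum.map (λ u≈1  → ≈-trans (s²≈c* u≈1)  (≈-reflexive (ℤₚ.*-identityʳ c)))
            (λ u≈-1 → ≈-trans (s²≈c* u≈-1) (≈-reflexive (trans (ℤₚ.*-comm c -1ℤ) (ℤₚ.-1*i≡-i c))))
            (±-roots (≈-refl {+ 1}) u²≈1)
    where
    m = 1 ℕ.+ 2 ℕ.* k
    u = c ^ m
    u²≈1 : u * u ≈ + 1
    u²≈1 = ≈-trans (≈-reflexive (trans (sym (ℤₚ.^-distribˡ-+-* c m m)) (cong (c ^_) m+m≡pred-p))) (fermat-unit p∤c)
      where
      m+m≡pred-p : m ℕ.+ m ≡ ℕ.pred p
      m+m≡pred-p = trans (cong (m ℕ.+_) (sym (ℕₚ.+-identityʳ m))) (sym pred-p≡2*odd)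
    s²≈c* : ∀ {v} → u ≈ v → c ^ suc k * c ^ suc k ≈ c * v
    s²≈c* u≈v = ≈-trans (≈-reflexive (trans (sym (ℤₚ.^-distribˡ-+-* c (suc k) (suc k))) (cong (c ^_) (arith k))))
                        (*-cong (≈-refl {c}) u≈v)
      where
      arith : ∀ k → suc k ℕ.+ suc k ≡ suc (1 ℕ.+ 2 ℕ.* k)
      arith = ℕSolver.solve-∀

  ¬square≈-square : ∀ {s} → ¬ + p ∣ s → ∀ w → ¬ w * w ≈ - (s * s)
  ¬square≈-square {s} p∤s w w²≈-s² = -1-nonSquare (w * v) (begin
    (w * v) * (w * v)        ≡⟨ regroup w v ⟩
    (w * w) * (v * v)        ≈⟨ *-cong w²≈-s² ≈-refl ⟩
    - (s * s) * (v * v)      ≡⟨ regroup′ s v ⟩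
    - ((s * v) * (s * v))    ≈⟨ neg-cong (*-cong (inv-inverseʳ p∤s) (inv-inverseʳ p∤s)) ⟩
    -1ℤ                      ∎)
    where
    open import Relation.Binary.Reasoning.Setoid ≈-setoid
    v = inv p s
    regroup : ∀ w v → (w * v) * (w * v) ≡ (w * w) * (v * v)
    regroup = solve-∀
    regroup′ : ∀ s v → - (s * s) * (v * v) ≡ - ((s * v) * (s * v))
    regroup′ = solve-∀

  rootCount-two-roots : ∀ {c s j₊ j₋} → s * s ≈ c → j₊ < p → + j₊ ≈ s → j₋ < p → + j₋ ≈ - s → ¬ j₊ ≡ j₋ →
                        rootCount c ≡ 2
  rootCount-two-roots {c} {s} {j₊} {j₋} s²≈c j₊<p j₊≈s j₋<p j₋≈-s j₊≢j₋ =
    trans (∑-cong p pointwise) (trans (∑-+ p _ _) (cong₂ ℕ._+_ (∑-δ p j₊<p) (∑-δ p j₋<p)))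
    where
    root : ∀ {j} z → + j ≈ z → z * z ≈ c → eqᵇ p (+ j * + j) c ≡ true
    root z j≈z z²≈c = eqᵇ-true (≈-trans (*-cong j≈z j≈z) z²≈c)
    [-s]²≈c : - s * - s ≈ c
    [-s]²≈c = ≈-trans (≈-reflexive (neg-square s)) s²≈c
      where
      neg-square : ∀ s → - s * - s ≡ s * s
      neg-square = solve-∀
    same-residue : ∀ {i j z} → i < p → j < p → + i ≈ z → + j ≈ z → i ≡ j
    same-residue i<p j<p i≈z j≈z = residue-injective i<p j<p (≈-trans i≈z (≈-sym j≈z))
    pointwise : ∀ j → j < p → χ (eqᵇ p (+ j * + j) c) ≡ δ j j₊ ℕ.+ δ j j₋
    pointwise j j<p with j ℕₚ.≟ j₊ | j ℕₚ.≟ j₋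
    ... | yes refl | yes j≡j₋ = ⊥-elim (j₊≢j₋ j≡j₋)
    ... | yes refl | no  j≢j₋ = trans (cong χ (root s j₊≈s s²≈c)) (sym (cong₂ ℕ._+_ (δ-refl j) (δ-≢ j≢j₋)))
    ... | no  j≢j₊ | yes refl = trans (cong χ (root (- s) j₋≈-s [-s]²≈c)) (sym (cong₂ ℕ._+_ (δ-≢ j≢j₊) (δ-refl j)))
    ... | no  j≢j₊ | no  j≢j₋ = trans (cong χ (eqᵇ-false (λ j²≈c →
      Sum.[ j≢j₊ ∘ (λ j≈s → same-residue j<p j₊<p j≈s j₊≈s) , j≢j₋ ∘ (λ j≈-s → same-residue j<p j₋<p j≈-s j₋≈-s) ]
        (±-roots s²≈c j²≈c))))
      (sym (cong₂ ℕ._+_ (δ-≢ j≢j₊) (δ-≢ j≢j₋)))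

  rootCount-square : ∀ {s c} → ¬ + p ∣ s → s * s ≈ c → rootCount c ≡ 2
  rootCount-square {s} p∤s s²≈c =
    rootCount-two-roots s²≈c (n%ℕd<d s p) (≈-sym (≈-%ℕ s)) (n%ℕd<d (- s) p) (≈-sym (≈-%ℕ (- s))) residues-differ
    where
    residues-differ : ¬ s %ℕ p ≡ (- s) %ℕ p
    residues-differ eq = p∤s (≈-neg-self⇒∣ (≈-trans (≈-%ℕ s) (≈-trans (≈-reflexive (cong +_ eq)) (≈-sym (≈-%ℕ (- s))))))

  rootCount-±-pair : ∀ {c} → ¬ + p ∣ c → rootCount c ℕ.+ rootCount (- c) ≡ 2
  rootCount-±-pair {c} p∤c = Sum.[ square , neg-square ] (square-or-neg-square p∤c)
    where
    s = c ^ suc k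
    p∤s : ¬ + p ∣ s
    p∤s = ∤-^ (suc k) p∤c
    square : s * s ≈ c → rootCount c ℕ.+ rootCount (- c) ≡ 2
    square s²≈c = cong₂ ℕ._+_ (rootCount-square p∤s s²≈c)
      (rootCount-nonSquare (λ w w²≈-c → ¬square≈-square p∤s w (≈-trans w²≈-c (neg-cong (≈-sym s²≈c)))))
    neg-square : s * s ≈ - c → rootCount c ℕ.+ rootCount (- c) ≡ 2
    neg-square s²≈-c = cong₂ ℕ._+_
      (rootCount-nonSquare (λ w w²≈c → ¬square≈-square p∤s w
        (≈-trans w²≈c (≈-sym (≈-trans (neg-cong s²≈-c) (≈-reflexive (ℤₚ.neg-involutive c)))))))
      (rootCount-square p∤s s²≈-c)

  ∑-rootCount-odd : ∀ (f : ℤ → ℤ) → (∀ {x y} → x ≈ y → f x ≈ f y) → (∀ x → f (- x) ≈ - f x) →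
                    ∑[ x < p ] rootCount (f (+ x)) ≡ p
  ∑-rootCount-odd f f-cong f-odd = ∑-negation-pairs p h (rootCount-zero (∣⇒≈0 (≈-neg-self⇒∣ (f-odd (+ 0))))) pairs
    where
    h : ℕ → ℕ
    h x = rootCount (f (+ x))
    pairs : ∀ i → 0 < i → i < p → h i ℕ.+ h (p ∸ i) ≡ 2
    pairs i _ i<p = by-cases (+ p ℤ∣.∣? f (+ i))
      where
      f[p-i]≈-fi : f (+ (p ∸ i)) ≈ - f (+ i)
      f[p-i]≈-fi = ≈-trans (f-cong (∸≈- (ℕₚ.<⇒≤ i<p))) (f-odd (+ i))
      by-cases : Dec (+ p ∣ f (+ i)) → h i ℕ.+ h (p ∸ i) ≡ 2
      by-cases (yes p∣fi) = cong₂ ℕ._+_ (rootCount-zero fi≈0) (rootCount-zero (≈-trans f[p-i]≈-fi (neg-cong fi≈0)))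
        where fi≈0 = ∣⇒≈0 p∣fi
      by-cases (no  p∤fi) = trans (cong (h i ℕ.+_) (rootCount-cong f[p-i]≈-fi)) (rootCount-±-pair p∤fi)

module Curve (p : ℕ) (p-prime : Prime p) (p≡3 : p % 4 ≡ 3) where

  open ThreeModFour p p-prime p≡3

  curveRHS-cong : ∀ a b {x y} → x ≈ y → curveRHS a b x ≈ curveRHS a b y
  curveRHS-cong a b x≈y = +-cong (+-cong (*-cong (*-cong x≈y x≈y) x≈y) (*-cong (≈-refl {a}) x≈y)) ≈-refl

  curveRHS-odd : ∀ a x → curveRHS a (+ 0) (- x) ≈ - curveRHS a (+ 0) x
  curveRHS-odd a x = ≈-reflexive (odd a x)
    where
    odd : ∀ a x → (- x) * (- x) * (- x) + a * (- x) + + 0 ≡ - (x * x * x + a * x + + 0)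
    odd = solve-∀

  numPoints≡p+1 : ∀ a → numPoints p a (+ 0) ≡ suc p
  numPoints≡p+1 a =
    cong suc (trans (count-grid _ +_ +_ p p) (∑-rootCount-odd (curveRHS a (+ 0)) (curveRHS-cong a (+ 0)) (curveRHS-odd a)))

  supersingular : ∀ a → Supersingular p a (+ 0)
  supersingular a = ≈⇒≡[] (≈-reflexive (trans (cong (λ N → + suc p - + N) (numPoints≡p+1 a)) (ℤₚ.+-inverseʳ (+ suc p))))

  elliptic : ∀ {a} → ¬ + p ∣ a → IsEllipticCurve p a (+ 0)
  elliptic {a} p∤a disc≡0 =
    ∤-* (∤-^ 6 p∤2) (∤-* (∤-* p∤a p∤a) p∤a) (∣-neg⁻¹ (subst (+ p ∣_) (disc-b≡0 a) (≈0⇒∣ (≡[]⇒≈ {disc a (+ 0)} disc≡0))))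
    where
    disc-b≡0 : ∀ a → - (+ 16) * (+ 4 * (a * a * a) + + 27 * (+ 0 * + 0)) ≡ - (+ 64 * (a * a * a))
    disc-b≡0 = solve-∀

  t²+1≢0 : ∀ t → ¬ + p ∣ - (t * t + + 1)
  t²+1≢0 t p∣ = -1-nonSquare t (≈-intro (∣-neg⁻¹ p∣))

  -- The left side is the x-coordinate that add computes for 2(x , y), where u = 1 / 2y.
  tangent-x-square : ∀ {a x y u} → y * y ≈ curveRHS a (+ 0) x → (+ 2 * y) * u ≈ + 1 →
    ((+ 3 * (x * x) + a) * u) * ((+ 3 * (x * x) + a) * u) - x - x ≈ ((x * x - a) * u) * ((x * x - a) * u)
  tangent-x-square {a} {x} {y} {u} on-curve 2yu≈1 =
    ≈-via _ (identity x y a u) (∣m∣n⇒∣m+n (∣n⇒∣m*n (+ 8 * x * u * u) (∣-difference (≈-sym on-curve)))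
                                         (∣n⇒∣m*n (+ 2 * x) (∣-difference (*-cong 2yu≈1 2yu≈1))))
    where
    identity : ∀ x y a u →
      ((+ 3 * (x * x) + a) * u) * ((+ 3 * (x * x) + a) * u) - x - x - ((x * x - a) * u) * ((x * x - a) * u)
        ≡ + 8 * x * u * u * ((x * x * x + a * x + + 0) - y * y) + + 2 * x * ((+ 2 * y) * u * ((+ 2 * y) * u) - + 1)
    identity = solve-∀

  not-halvable : ∀ {a} t → ¬ ∃ λ (Q : Pt) → OnCurve p a (+ 0) Q × (add p a Q Q ≈[ p ]ₚ pt -1ℤ t)
  not-halvable t (O , _ , ())
  not-halvable {a} t (pt x y , on-curve , 2Q≈) with eqᵇ p x x | eqᵇ-true (≈-refl {x})
  ... | .true | refl with p ℕ∣.∣? ∣ y + y - + 0 ∣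
  ... | yes _    = 2Q≈
  ... | no  2y≉0 = -1-nonSquare ((x * x - a) * u)
    (≈-trans (≈-sym (tangent-x-square {a} {x} {y} {u} (≡[]⇒≈ {y * y} on-curve) (inv-inverseʳ p∤2y)))
             (≡[]⇒≈ {x₃} (proj₁ 2Q≈)))
    where
    u = inv p (+ 2 * y)
    x₃ = ((+ 3 * (x * x) + a) * u) * ((+ 3 * (x * x) + a) * u) - x - x
    p∤2y : ¬ + p ∣ + 2 * y
    p∤2y p∣2y = 2y≉0 (≈⇒≡[] (≈-via {y + y} {+ 0} (+ 2 * y) (double y) p∣2y))
      where
      double : ∀ y → y + y - + 0 ≡ + 2 * y
      double = solve-∀

proposition1 : (p : ℕ) → Prime p → p % 4 ≡ 3 → (t : ℤ) →
  IsEllipticCurve p (- (t * t + + 1)) (+ 0)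
  × Supersingular p (- (t * t + + 1)) (+ 0)
  × ¬ (∃ λ (Q : Pt) → OnCurve p (- (t * t + + 1)) (+ 0) Q
                       × (add p (- (t * t + + 1)) Q Q ≈[ p ]ₚ pt (- (+ 1)) t))
proposition1 p p-prime p≡3 t = elliptic (t²+1≢0 t) , supersingular (- (t * t + + 1)) , not-halvable t
  where open Curve p p-prime p≡3
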